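{- For every $n\ge 3$, the cycle $C_n$ on $n$ vertices satisfies $\phi(C_n)\le\beta^n$, where $\beta=6^{1/4}$. Furthermore, $\phi(C_n)=\beta^n$ if and only if $n=4$.
   Context: A subset of vertices $F$ of a graph $G$ is a dissociation set if the induced subgraph $G[F]$ has maximum degree at most $1$. A maximal dissociation set is a dissociation set that is not a proper subset of any other dissociation set. $\phi(G)$ denotes the number of maximal dissociation sets of $G$. -}

module Defs where

open import Data.Nat using (ℕ; zero; suc; _≤_; _∸_; ∣_-_∣; _≟_; _≤?_)
open import Data.Bool using (Bool)
open import Data.Fin using (Fin; toℕ)
open import Data.Fin.Subset using (Subset; _∈_; _⊂_; _∩_; ∣_∣; inside; outside)
open import Data.Fin.Subset.Properties using (_∈?_; _⊂?_; anySubset?)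
open import Data.Fin.Properties using (all?)
open import Data.List using (List; []; _∷_; _++_; map; filter; length)
open import Data.Product using (_×_; ∃; _,_)
open import Data.Sum using (_⊎_)
open import Data.Vec using (Vec; []; _∷_; tabulate)
open import Relation.Nullary using (¬_; Dec; yes; no; _×-dec_; _⊎-dec_; ¬?; _→-dec_)
open import Relation.Binary.PropositionalEquality using (_≡_)

-- The cycle C_n on vertices 0,…,n-1: i ~ j iff |i - j| = 1 or |i - j| = n - 1
-- (for n ≥ 3 this is the usual simple n-cycle 0-1-2-…-(n-1)-0).
CycleAdj : (n : ℕ) → Fin n → Fin n → Set
CycleAdj n i j = (∣ toℕ i - toℕ j ∣ ≡ 1) ⊎ (∣ toℕ i - toℕ j ∣ ≡ n ∸ 1)

cycleAdj? : (n : ℕ) → (i j : Fin n) → Dec (CycleAdj n i j)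
cycleAdj? n i j = (∣ toℕ i - toℕ j ∣ ≟ 1) ⊎-dec (∣ toℕ i - toℕ j ∣ ≟ n ∸ 1)

nbhd : (n : ℕ) → Fin n → Subset n
nbhd n v = tabulate λ u → Relation.Nullary.does (cycleAdj? n v u)
  where import Relation.Nullary

degIn : (n : ℕ) → Subset n → Fin n → ℕ
degIn n F v = ∣ F ∩ nbhd n v ∣

IsDissociation : (n : ℕ) → Subset n → Set
IsDissociation n F = ∀ v → v ∈ F → degIn n F v ≤ 1

isDissociation? : (n : ℕ) → (F : Subset n) → Dec (IsDissociation n F)
isDissociation? n F = all? λ v → (v ∈? F) →-dec (degIn n F v ≤? 1)

IsMaximalDissociation : (n : ℕ) → Subset n → Set
IsMaximalDissociation n F =
  IsDissociation n F × ¬ (∃ λ G → F ⊂ G × IsDissociation n G)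

isMaximalDissociation? : (n : ℕ) → (F : Subset n) → Dec (IsMaximalDissociation n F)
isMaximalDissociation? n F =
  isDissociation? n F ×-dec ¬? (anySubset? λ G → (F ⊂? G) ×-dec isDissociation? n G)

allSubsets : (n : ℕ) → List (Subset n)
allSubsets zero = [] ∷ []
allSubsets (suc n) = map (inside ∷_) (allSubsets n) ++ map (outside ∷_) (allSubsets n)

φC : ℕ → ℕ
φC n = length (filter (isMaximalDissociation? n) (allSubsets n))

module Submission where

-- Read a maximal dissociation set F of C_n as the word F(0) … F(n-1). Away from the
-- wrap-around edge, F has no three consecutive vertices, and every vertex outside F
-- is blocked: adding it would give it, or one of its neighbours, degree 2. These local
-- rules are checked by an automaton reading the word, so φ(C_n) is at most the number
-- N_n of accepted words. A positive weight w on automaton states with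
-- 11 · Σ w(successors) ≤ 16 · w bounds N_n by (16/11)^n · w(start) / min w, and since
-- (16/11)^4 < 6 this is below 6^{n/4} once n ≥ 34. The cases n < 34 are computed; only
-- n = 4 attains φ(C_4)^4 = 6^4.

open import Defs
open import Data.Bool using (Bool; true; false; _∧_; _∨_; not; T; if_then_else_)
open import Data.Bool.Properties
  using (T?; T-≡; T-∧; ∧-conicalˡ; ∧-conicalʳ; ∧-identityʳ; ∧-zeroʳ; ∨-identityʳ)
open import Data.Empty using (⊥-elim)
open import Data.Fin using (Fin; toℕ; fromℕ<) renaming (zero to fzero; suc to fsuc)
open import Data.Fin.Properties using (toℕ-fromℕ<; toℕ<n)
open import Data.Fin.Subset using (Subset; _∈_; _∉_; _∩_; _∪_; _⊂_; ⁅_⁆; ∣_∣) renaming (⊥ to ∅)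
open import Data.Fin.Subset.Properties using (p⊆p∪q; x∈p∪q⁺; x∈⁅x⁆)
open import Data.List using (List; []; _∷_; _++_; map; filter; length; take)
open import Data.Nat
  using ( ℕ; zero; suc; _+_; _*_; _^_; _∸_; _≤_; _<_; z≤n; s≤s; ∣_-_∣; NonZero
        ; _≟_; _<?_; _≤ᵇ_; _<ᵇ_; _≡ᵇ_)
open import Data.Nat.Properties
open import Algebra.Properties.CommutativeSemigroup *-commutativeSemigroup
  using (x∙yz≈y∙xz; x∙yz≈z∙xy; interchange)
open import Data.Product using (_×_; _,_; proj₂)
open import Data.Sum using (_⊎_; inj₁; inj₂; [_,_]′)
import Data.Sum as Sum
open import Data.Vec using (Vec; []; _∷_; tabulate; here; there)
open import Function using (_∘_)
open import Function.Bundles using (Equivalence; _⇔_; mk⇔)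
open import Relation.Binary.PropositionalEquality
open import Relation.Nullary using (¬_; Dec; yes; no; does; contradiction)
open import Relation.Nullary.Decidable using (dec-true; decidable-stable)
open import Relation.Unary using (Decidable)

bit : Bool → ℕ
bit true = 1
bit false = 0

-- Membership of a position k : ℕ; false for k ≥ n.
χ : ∀ {n} → Subset n → ℕ → Bool
χ [] k = false
χ (b ∷ p) zero = b
χ (b ∷ p) (suc k) = χ p k

χ-∩ : ∀ {n} (p q : Subset n) k → χ (p ∩ q) k ≡ χ p k ∧ χ q k
χ-∩ [] [] k = refl
χ-∩ (a ∷ p) (b ∷ q) zero = refl
χ-∩ (a ∷ p) (b ∷ q) (suc k) = χ-∩ p q k

χ-∪ : ∀ {n} (p q : Subset n) k → χ (p ∪ q) k ≡ χ p k ∨ χ q k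
χ-∪ [] [] k = refl
χ-∪ (a ∷ p) (b ∷ q) zero = refl
χ-∪ (a ∷ p) (b ∷ q) (suc k) = χ-∪ p q k

χ⇒< : ∀ {n} (p : Subset n) {k} → χ p k ≡ true → k < n
χ⇒< (b ∷ p) {zero} _ = s≤s z≤n
χ⇒< (b ∷ p) {suc k} e = s≤s (χ⇒< p e)

∈⇒χ : ∀ {n} {p : Subset n} {u} → u ∈ p → χ p (toℕ u) ≡ true
∈⇒χ here = refl
∈⇒χ (there u∈p) = ∈⇒χ u∈p

χ⇒∈ : ∀ {n} (p : Subset n) u → χ p (toℕ u) ≡ true → u ∈ p
χ⇒∈ (true ∷ p) fzero _ = here
χ⇒∈ (b ∷ p) (fsuc u) e = there (χ⇒∈ p u e)

χ-ext : ∀ {n} (p q : Subset n) → (∀ k → χ p k ≡ χ q k) → p ≡ q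
χ-ext [] [] _ = refl
χ-ext (a ∷ p) (b ∷ q) eq = cong₂ _∷_ (eq zero) (χ-ext p q (eq ∘ suc))

χ-tabulate : ∀ {n} (f : Fin n → Bool) u → χ (tabulate f) (toℕ u) ≡ f u
χ-tabulate f fzero = refl
χ-tabulate f (fsuc u) = χ-tabulate (f ∘ fsuc) u

χ-tabulate′ : ∀ {n} (f : Fin n → Bool) {k} (k<n : k < n) → χ (tabulate f) k ≡ f (fromℕ< k<n)
χ-tabulate′ f k<n =
  subst (λ i → χ (tabulate f) i ≡ f (fromℕ< k<n)) (toℕ-fromℕ< k<n) (χ-tabulate f _)

χ-∅ : ∀ {n} k → χ (∅ {n}) k ≡ false
χ-∅ {zero} k = refl
χ-∅ {suc n} zero = refl
χ-∅ {suc n} (suc k) = χ-∅ {n} k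

χ-⁅⁆ : ∀ {n} (v : Fin n) {k} → k ≢ toℕ v → χ ⁅ v ⁆ k ≡ false
χ-⁅⁆ fzero {zero} k≢0 = contradiction refl k≢0
χ-⁅⁆ {suc n} fzero {suc k} _ = χ-∅ {n} k
χ-⁅⁆ (fsuc v) {zero} _ = refl
χ-⁅⁆ (fsuc v) {suc k} k≢1+v = χ-⁅⁆ v (k≢1+v ∘ cong suc)

χ-∪⁅⁆ : ∀ {n} (p : Subset n) v {k} → k ≢ toℕ v → χ (p ∪ ⁅ v ⁆) k ≡ χ p k
χ-∪⁅⁆ p v {k} k≢v =
  trans (χ-∪ p ⁅ v ⁆ k) (trans (cong (χ p k ∨_) (χ-⁅⁆ v k≢v)) (∨-identityʳ (χ p k)))

∣b∷p∣≡bit+∣p∣ : ∀ {n} b (p : Subset n) → ∣ b ∷ p ∣ ≡ bit b + ∣ p ∣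
∣b∷p∣≡bit+∣p∣ true p = refl
∣b∷p∣≡bit+∣p∣ false p = refl

∣p∣≡0 : ∀ {n} (p : Subset n) → (∀ k → χ p k ≢ true) → ∣ p ∣ ≡ 0
∣p∣≡0 [] _ = refl
∣p∣≡0 (true ∷ p) none = contradiction refl (none 0)
∣p∣≡0 (false ∷ p) none = ∣p∣≡0 p (none ∘ suc)

∣p∣≡bit : ∀ {n} (p : Subset n) x → (∀ k → χ p k ≡ true → k ≡ x) → ∣ p ∣ ≡ bit (χ p x)
∣p∣≡bit [] x _ = refl
∣p∣≡bit (b ∷ p) zero only = begin
  ∣ b ∷ p ∣     ≡⟨ ∣b∷p∣≡bit+∣p∣ b p ⟩
  bit b + ∣ p ∣ ≡⟨ cong (bit b +_) (∣p∣≡0 p (λ k → 0≢1+n ∘ sym ∘ only (suc k))) ⟩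
  bit b + 0     ≡⟨ +-identityʳ (bit b) ⟩
  bit b         ∎
  where open ≡-Reasoning
∣p∣≡bit (true ∷ p) (suc x) only = contradiction (only 0 refl) 0≢1+n
∣p∣≡bit (false ∷ p) (suc x) only = ∣p∣≡bit p x (λ k → suc-injective ∘ only (suc k))

∣p∣≡bit+bit : ∀ {n} (p : Subset n) {x y} → x < y → (∀ k → χ p k ≡ true → k ≡ x ⊎ k ≡ y) →
              ∣ p ∣ ≡ bit (χ p x) + bit (χ p y)
∣p∣≡bit+bit [] _ _ = refl
∣p∣≡bit+bit (b ∷ p) {zero} {suc y} _ only = trans (∣b∷p∣≡bit+∣p∣ b p)
  (cong (bit b +_) (∣p∣≡bit p y λ k e → [ (λ ()) , suc-injective ]′ (only (suc k) e)))
∣p∣≡bit+bit (true ∷ p) {suc x} {suc y} _ only = contradiction (only 0 refl) [ 0≢1+n , 0≢1+n ]′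
∣p∣≡bit+bit (false ∷ p) {suc x} {suc y} (s≤s x<y) only =
  ∣p∣≡bit+bit p x<y λ k e → Sum.map suc-injective suc-injective (only (suc k) e)

∣-∣≡⇒ : ∀ x y {d} → ∣ x - y ∣ ≡ d → x ≡ y + d ⊎ y ≡ x + d
∣-∣≡⇒ zero y e = inj₂ e
∣-∣≡⇒ (suc x) zero e = inj₁ e
∣-∣≡⇒ (suc x) (suc y) e = Sum.map (cong suc) (cong suc) (∣-∣≡⇒ x y e)

∣1+m-m∣≡1 : ∀ m → ∣ suc m - m ∣ ≡ 1
∣1+m-m∣≡1 zero = refl
∣1+m-m∣≡1 (suc m) = ∣1+m-m∣≡1 m

Adjacent : ℕ → ℕ → ℕ → Set
Adjacent n x y = ∣ x - y ∣ ≡ 1 ⊎ ∣ x - y ∣ ≡ n ∸ 1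

Adjacent-sym : ∀ {n x y} → Adjacent n x y → Adjacent n y x
Adjacent-sym {x = x} {y} = Sum.map (trans (∣-∣-comm y x)) (trans (∣-∣-comm y x))

adjacent-interior : ∀ {n m y} → suc (suc m) < n → y < n → Adjacent n (suc m) y →
                    y ≡ m ⊎ y ≡ suc (suc m)
adjacent-interior {suc n} {m} {y} _ _ (inj₁ d≡1) with ∣-∣≡⇒ (suc m) y d≡1
... | inj₁ 1+m≡y+1 = inj₁ (suc-injective (trans (+-comm 1 y) (sym 1+m≡y+1)))
... | inj₂ y≡1+m+1 = inj₂ (trans y≡1+m+1 (+-comm (suc m) 1))
adjacent-interior {suc n} {m} {y} (s≤s m+2≤n) y≤n (inj₂ d≡n) with ∣-∣≡⇒ (suc m) y d≡n
... | inj₁ 1+m≡y+n = contradiction (≤-trans (m≤n+m n y) (≤-reflexive (sym 1+m≡y+n))) (<⇒≱ m+2≤n)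
... | inj₂ y≡1+m+n = contradiction (s≤s (m≤n+m n m)) (<⇒≱ (subst (_< suc n) y≡1+m+n y≤n))

does≡true⇒ : ∀ {A : Set} (a? : Dec A) → does a? ≡ true → A
does≡true⇒ (yes a) _ = a

χ-nbhd⁻ : ∀ {n} (w : Fin n) {k} → χ (nbhd n w) k ≡ true → k < n × Adjacent n (toℕ w) k
χ-nbhd⁻ {n} w e = k<n , subst (Adjacent n (toℕ w)) (toℕ-fromℕ< k<n)
  (does≡true⇒ (cycleAdj? n w _) (trans (sym (χ-tabulate′ (λ u → does (cycleAdj? n w u)) k<n)) e))
  where k<n = χ⇒< (nbhd n w) e

χ-nbhd⁺ : ∀ {n} (w : Fin n) {k} → k < n → ∣ toℕ w - k ∣ ≡ 1 → χ (nbhd n w) k ≡ true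
χ-nbhd⁺ {n} w k<n d≡1 = trans (χ-tabulate′ (λ u → does (cycleAdj? n w u)) k<n)
  (dec-true (cycleAdj? n w (fromℕ< k<n))
    (inj₁ (subst (λ i → ∣ toℕ w - i ∣ ≡ 1) (sym (toℕ-fromℕ< k<n)) d≡1)))

nbhd-interior : ∀ {n} (w : Fin n) {m} → toℕ w ≡ suc m → suc (suc m) < n →
                ∀ {k} → χ (nbhd n w) k ≡ true → k ≡ m ⊎ k ≡ suc (suc m)
nbhd-interior {n} w w≡1+m m+2<n e with χ-nbhd⁻ w e
... | k<n , adj = adjacent-interior m+2<n k<n (subst (λ x → Adjacent n x _) w≡1+m adj)

degIn-interior : ∀ {n} (G : Subset n) (w : Fin n) {m} → toℕ w ≡ suc m → suc (suc m) < n →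
                 degIn n G w ≡ bit (χ G m) + bit (χ G (suc (suc m)))
degIn-interior {n} G w {m} w≡1+m m+2<n = begin
  ∣ G ∩ N ∣
    ≡⟨ ∣p∣≡bit+bit (G ∩ N) (s≤s (n≤1+n m)) inN ⟩
  bit (χ (G ∩ N) m) + bit (χ (G ∩ N) (suc (suc m)))
    ≡⟨ cong₂ (λ a b → bit a + bit b) (χ-∩N m left) (χ-∩N _ right) ⟩
  bit (χ G m) + bit (χ G (suc (suc m)))
    ∎
  where
    open ≡-Reasoning
    N = nbhd n w
    inN : ∀ k → χ (G ∩ N) k ≡ true → k ≡ m ⊎ k ≡ suc (suc m)
    inN k e = nbhd-interior w w≡1+m m+2<n (∧-conicalʳ (χ G k) _ (trans (sym (χ-∩ G N k)) e))
    χ-∩N : ∀ k → χ N k ≡ true → χ (G ∩ N) k ≡ χ G k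
    χ-∩N k Nk = trans (χ-∩ G N k) (trans (cong (χ G k ∧_) Nk) (∧-identityʳ (χ G k)))
    left : χ N m ≡ true
    left = χ-nbhd⁺ w (m+n≤o⇒n≤o 2 m+2<n)
             (trans (cong (∣_- m ∣) w≡1+m) (∣1+m-m∣≡1 m))
    right : χ N (suc (suc m)) ≡ true
    right = χ-nbhd⁺ w m+2<n
              (trans (cong (∣_- suc (suc m) ∣) w≡1+m) (trans (∣-∣-comm m (suc m)) (∣1+m-m∣≡1 m)))

degIn-cong : ∀ {n} (F G : Subset n) w → (∀ k → χ (nbhd n w) k ≡ true → χ G k ≡ χ F k) →
             degIn n G w ≡ degIn n F w
degIn-cong {n} F G w agree = cong ∣_∣ (χ-ext (G ∩ N) (F ∩ N) λ k → begin
  χ (G ∩ N) k       ≡⟨ χ-∩ G N k ⟩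
  χ G k ∧ χ N k     ≡⟨ on-support (χ N k) (agree k) ⟩
  χ F k ∧ χ N k     ≡⟨ χ-∩ F N k ⟨
  χ (F ∩ N) k       ∎)
  where
    open ≡-Reasoning
    N = nbhd n w
    on-support : ∀ {a b} c → (c ≡ true → a ≡ b) → a ∧ c ≡ b ∧ c
    on-support true a≡b = cong (_∧ true) (a≡b refl)
    on-support {a} {b} false _ = trans (∧-zeroʳ a) (sym (∧-zeroʳ b))

-- Local structure of maximal dissociation sets

noTriple : Bool → Bool → Bool → Bool
noTriple a b c = not (a ∧ b ∧ c)

-- The middle position c is occupied, or occupying it would give c, b or d two neighbours.
saturated : Bool → Bool → Bool → Bool → Bool → Bool
saturated a b c d e = c ∨ (b ∧ d) ∨ (a ∧ b) ∨ (d ∧ e)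

noTriple-intro : ∀ {a b c} → (b ≡ true → bit a + bit c ≤ 1) → T (noTriple a b c)
noTriple-intro {true} {true} {true} h = contradiction (h refl) λ { (s≤s ()) }
noTriple-intro {true} {true} {false} _ = _
noTriple-intro {true} {false} _ = _
noTriple-intro {false} _ = _

unsaturated : ∀ a b c d e → ¬ T (saturated a b c d e) →
              c ≡ false × bit b + bit d ≤ 1 × (b ≡ true → a ≡ false) × (d ≡ true → e ≡ false)
unsaturated a b true d e ¬sat = contradiction _ ¬sat
unsaturated a true false true e ¬sat = contradiction _ ¬sat
unsaturated true true false false e ¬sat = contradiction _ ¬sat
unsaturated false true false false e ¬sat = refl , ≤-refl , (λ _ → refl) , λ ()
unsaturated true false false true true ¬sat = contradiction _ ¬sat
unsaturated false false false true true ¬sat = contradiction _ ¬sat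
unsaturated a false false true false ¬sat = refl , ≤-refl , (λ ()) , λ _ → refl
unsaturated a false false false e ¬sat = refl , z≤n , (λ ()) , λ ()

dissociation⇒neighbours≤1 : ∀ {n} {F : Subset n} {m} → IsDissociation n F → suc (suc m) < n →
                            χ F (suc m) ≡ true → bit (χ F m) + bit (χ F (suc (suc m))) ≤ 1
dissociation⇒neighbours≤1 {n} {F} dis m+2<n F[1+m] =
  subst (_≤ 1) (degIn-interior F u u≡1+m m+2<n)
    (dis u (χ⇒∈ F u (subst (λ i → χ F i ≡ true) (sym u≡1+m) F[1+m])))
  where
    u = fromℕ< (m+n≤o⇒n≤o 1 m+2<n)
    u≡1+m = toℕ-fromℕ< (m+n≤o⇒n≤o 1 m+2<n)

dissociation⇒noTriple : ∀ {n} {F : Subset n} {i} → IsDissociation n F → suc (suc i) < n →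
                        T (noTriple (χ F i) (χ F (suc i)) (χ F (suc (suc i))))
dissociation⇒noTriple {F = F} {i} dis i+2<n =
  noTriple-intro {χ F i} {_} {χ F (suc (suc i))} (dissociation⇒neighbours≤1 dis i+2<n)

dissociation-extend : ∀ {n} {F G : Subset n} {i} → IsDissociation n F → suc (suc (suc (suc i))) < n →
  χ G (suc (suc i)) ≡ true → (∀ k → k ≢ suc (suc i) → χ G k ≡ χ F k) →
  bit (χ F (suc i)) + bit (χ F (suc (suc (suc i)))) ≤ 1 →
  (χ F (suc i) ≡ true → χ F i ≡ false) →
  (χ F (suc (suc (suc i))) ≡ true → χ F (suc (suc (suc (suc i)))) ≡ false) →
  IsDissociation n G
dissociation-extend {n} {F} {G} {i} dis i+4<n G[j] G≈F centre left right w w∈G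
  with toℕ w ≟ suc (suc i)
... | yes w≡j = begin
  degIn n G w                                         ≡⟨ degIn-interior G w w≡j (m+n≤o⇒n≤o 1 i+4<n) ⟩
  bit (χ G (suc i)) + bit (χ G (suc (suc (suc i))))   ≡⟨ cong₂ (λ a b → bit a + bit b)
                                                           (G≈F _ (<⇒≢ (n<1+n _))) (G≈F _ (>⇒≢ (n<1+n _))) ⟩
  bit (χ F (suc i)) + bit (χ F (suc (suc (suc i))))   ≤⟨ centre ⟩
  1                                                   ∎
  where open ≤-Reasoning
... | no w≢j = degree-away (trans (sym (G≈F _ w≢j)) (∈⇒χ w∈G))
  where
    open ≤-Reasoning
    degree-away : χ F (toℕ w) ≡ true → degIn n G w ≤ 1
    degree-away F[w] with χ (nbhd n w) (suc (suc i)) in N[j]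
    ... | false = begin
      degIn n G w   ≡⟨ degIn-cong F G w (λ k N[k] → G≈F k (≢j N[k])) ⟩
      degIn n F w   ≤⟨ dis w (χ⇒∈ F w F[w]) ⟩
      1             ∎
      where
        ≢j : ∀ {k} → χ (nbhd n w) k ≡ true → k ≢ suc (suc i)
        ≢j N[k] refl = contradiction (trans (sym N[k]) N[j]) λ ()
    ... | true
      with adjacent-interior (m+n≤o⇒n≤o 1 i+4<n) (toℕ<n w) (Adjacent-sym {n} {toℕ w} (proj₂ (χ-nbhd⁻ w N[j])))
    ...   | inj₁ w≡1+i = begin
      degIn n G w                             ≡⟨ degIn-interior G w w≡1+i (m+n≤o⇒n≤o 2 i+4<n) ⟩
      bit (χ G i) + bit (χ G (suc (suc i)))   ≡⟨ cong₂ (λ a b → bit a + bit b) G[i] G[j] ⟩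
      1                                       ∎
      where
        G[i] = trans (G≈F i (<⇒≢ (m<n⇒m<1+n (n<1+n i))))
                     (left (subst (λ x → χ F x ≡ true) w≡1+i F[w]))
    ...   | inj₂ w≡3+i = begin
      degIn n G w                                                     ≡⟨ degIn-interior G w w≡3+i i+4<n ⟩
      bit (χ G (suc (suc i))) + bit (χ G (suc (suc (suc (suc i)))))   ≡⟨ cong₂ (λ a b → bit a + bit b) G[j] G[4+i] ⟩
      1                                                               ∎
      where
        G[4+i] = trans (G≈F _ (>⇒≢ (m<n⇒m<1+n (n<1+n _))))
                       (right (subst (λ x → χ F x ≡ true) w≡3+i F[w]))

⊂-∪⁅⁆ : ∀ {n} {p : Subset n} {v} → v ∉ p → p ⊂ p ∪ ⁅ v ⁆
⊂-∪⁅⁆ {v = v} v∉p = p⊆p∪q ⁅ v ⁆ , v , x∈p∪q⁺ (inj₂ (x∈⁅x⁆ v)) , v∉p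

maximal⇒saturated : ∀ {n} {F : Subset n} {i} → IsMaximalDissociation n F → suc (suc (suc (suc i))) < n →
  T (saturated (χ F i) (χ F (suc i)) (χ F (suc (suc i))) (χ F (suc (suc (suc i)))) (χ F (suc (suc (suc (suc i))))))
maximal⇒saturated {n} {F} {i} (dis , maximal) i+4<n = decidable-stable (T? _) λ ¬sat →
  let F[j]≡false , centre , left , right = unsaturated _ _ _ _ _ ¬sat
      v∉F v∈F = contradiction (trans (sym (subst (λ x → χ F x ≡ true) v≡j (∈⇒χ v∈F))) F[j]≡false) λ ()
      G≈F k k≢j = χ-∪⁅⁆ F v (subst (k ≢_) (sym v≡j) k≢j)
  in maximal (F ∪ ⁅ v ⁆ , ⊂-∪⁅⁆ v∉F , dissociation-extend dis i+4<n G[j] G≈F centre left right)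
  where
    j<n = m+n≤o⇒n≤o 2 i+4<n
    v = fromℕ< j<n
    v≡j = toℕ-fromℕ< j<n
    G[j] = subst (λ x → χ (F ∪ ⁅ v ⁆) x ≡ true) v≡j
             (∈⇒χ {p = F ∪ ⁅ v ⁆} (x∈p∪q⁺ (inj₂ (x∈⁅x⁆ v))))

-- Counting the words accepted by an automaton

countᵇ : ∀ {A : Set} → (A → Bool) → List A → ℕ
countᵇ p [] = 0
countᵇ p (x ∷ xs) = bit (p x) + countᵇ p xs

module _ {A : Set} where

  countᵇ-++ : ∀ (p : A → Bool) xs ys → countᵇ p (xs ++ ys) ≡ countᵇ p xs + countᵇ p ys
  countᵇ-++ p [] ys = refl
  countᵇ-++ p (x ∷ xs) ys =
    trans (cong (bit (p x) +_) (countᵇ-++ p xs ys)) (sym (+-assoc (bit (p x)) _ _))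

  countᵇ-map : ∀ {B : Set} (p : B → Bool) (f : A → B) xs → countᵇ p (map f xs) ≡ countᵇ (p ∘ f) xs
  countᵇ-map p f [] = refl
  countᵇ-map p f (x ∷ xs) = cong (bit (p (f x)) +_) (countᵇ-map p f xs)

  countᵇ-∧ : ∀ b (p : A → Bool) xs → countᵇ (λ x → b ∧ p x) xs ≡ (if b then countᵇ p xs else 0)
  countᵇ-∧ true p xs = refl
  countᵇ-∧ false p [] = refl
  countᵇ-∧ false p (x ∷ xs) = countᵇ-∧ false p xs

  length-filter≤countᵇ : ∀ {P : A → Set} (P? : Decidable P) (p : A → Bool) → (∀ x → P x → T (p x)) →
                         ∀ xs → length (filter P? xs) ≤ countᵇ p xs
  length-filter≤countᵇ P? p P⇒p [] = z≤n
  length-filter≤countᵇ P? p P⇒p (x ∷ xs) with P? x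
  ... | no _ = ≤-trans (length-filter≤countᵇ P? p P⇒p xs) (m≤n+m _ (bit (p x)))
  ... | yes Px with p x | P⇒p x Px
  ...   | true | _ = s≤s (length-filter≤countᵇ P? p P⇒p xs)

if-* : ∀ b c x → (if b then c * x else 0) ≡ c * (if b then x else 0)
if-* true c x = refl
if-* false c x = sym (*-zeroʳ c)

if-mono : ∀ b {x y} → x ≤ y → (if b then x else 0) ≤ (if b then y else 0)
if-mono true x≤y = x≤y
if-mono false _ = z≤n

module Automaton {S : Set} (admits : S → Bool → Bool) (step : S → Bool → S) where

  next : (S → ℕ) → S → ℕ
  next f s = (if admits s true then f (step s true) else 0)
           + (if admits s false then f (step s false) else 0)

  count : S → ℕ → ℕ
  count s zero = 1
  count s (suc n) = next (λ t → count t n) s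

  accepts : ∀ {n} → S → Vec Bool n → Bool
  accepts s [] = true
  accepts s (e ∷ v) = admits s e ∧ accepts (step s e) v

  countᵇ-accepts : ∀ n s → countᵇ (accepts s) (allSubsets n) ≡ count s n
  countᵇ-accepts zero s = refl
  countᵇ-accepts (suc n) s = begin
    countᵇ (accepts s) (map (true ∷_) A ++ map (false ∷_) A)
      ≡⟨ countᵇ-++ (accepts s) (map (true ∷_) A) _ ⟩
    countᵇ (accepts s) (map (true ∷_) A) + countᵇ (accepts s) (map (false ∷_) A)
      ≡⟨ cong₂ _+_ (countᵇ-map (accepts s) (true ∷_) A) (countᵇ-map (accepts s) (false ∷_) A) ⟩
    countᵇ (λ v → admits s true ∧ accepts (step s true) v) A
      + countᵇ (λ v → admits s false ∧ accepts (step s false) v) A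
      ≡⟨ cong₂ _+_ (countᵇ-∧ (admits s true) _ A) (countᵇ-∧ (admits s false) _ A) ⟩
    (if admits s true then countᵇ (accepts (step s true)) A else 0)
      + (if admits s false then countᵇ (accepts (step s false)) A else 0)
      ≡⟨ cong₂ (λ x y → (if admits s true then x else 0) + (if admits s false then y else 0))
           (countᵇ-accepts n (step s true)) (countᵇ-accepts n (step s false)) ⟩
    count s (suc n) ∎
    where
      open ≡-Reasoning
      A = allSubsets n

  next-* : ∀ c f s → next (λ t → c * f t) s ≡ c * next f s
  next-* c f s = trans
    (cong₂ _+_ (if-* (admits s true) c _) (if-* (admits s false) c _))
    (sym (*-distribˡ-+ c _ _))

  next-mono : ∀ {f g} → (∀ t → f t ≤ g t) → ∀ s → next f s ≤ next g s
  next-mono f≤g s = +-mono-≤ (if-mono (admits s true) (f≤g _)) (if-mono (admits s false) (f≤g _))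

  count-bound : ∀ (w : S → ℕ) {a b m} → (∀ s → m ≤ w s) → (∀ s → a * next w s ≤ b * w s) →
                ∀ n s → a ^ n * (m * count s n) ≤ b ^ n * w s
  count-bound w {a} {b} {m} m≤w contract zero s = +-monoˡ-≤ 0 (≤-trans (≤-reflexive (*-identityʳ m)) (m≤w s))
  count-bound w {a} {b} {m} m≤w contract (suc n) s = begin
    a ^ suc n * (m * next (λ t → count t n) s)        ≡⟨ *-assoc a (a ^ n) _ ⟩
    a * (a ^ n * (m * next (λ t → count t n) s))      ≡⟨ cong (a *_) scale ⟨
    a * next (λ t → a ^ n * (m * count t n)) s        ≤⟨ *-monoʳ-≤ a (next-mono (λ t → count-bound w m≤w contract n t) s) ⟩
    a * next (λ t → b ^ n * w t) s                    ≡⟨ cong (a *_) (next-* (b ^ n) w s) ⟩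
    a * (b ^ n * next w s)                            ≡⟨ x∙yz≈y∙xz a (b ^ n) _ ⟩
    b ^ n * (a * next w s)                            ≤⟨ *-monoʳ-≤ (b ^ n) (contract s) ⟩
    b ^ n * (b * w s)                                 ≡⟨ x∙yz≈y∙xz (b ^ n) b (w s) ⟩
    b * (b ^ n * w s)                                 ≡⟨ *-assoc b (b ^ n) (w s) ⟨
    b ^ suc n * w s                                   ∎
    where
      open ≤-Reasoning
      scale : next (λ t → a ^ n * (m * count t n)) s ≡ a ^ n * (m * next (λ t → count t n) s)
      scale = trans (next-* (a ^ n) (λ t → m * count t n) s) (cong (a ^ n *_) (next-* m (λ t → count t n) s))

-- The automaton of maximal dissociation sets

-- A state is the word read so far, most recent letter first.
admits : List Bool → Bool → Bool
admits (d ∷ c ∷ b ∷ a ∷ _) e = noTriple c d e ∧ saturated a b c d e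
admits (d ∷ c ∷ _) e = noTriple c d e
admits _ _ = true

open Automaton admits (λ h e → e ∷ h)

history : (ℕ → Bool) → ℕ → List Bool
history f zero = []
history f (suc j) = f j ∷ history f j

AdmissibleAt : (ℕ → Bool) → ℕ → Set
AdmissibleAt f j = T (admits (history f j) (f j))

accepts-history : ∀ (f : ℕ → Bool) j {k} (v : Vec Bool k) → (∀ i → χ v i ≡ f (j + i)) →
                  (∀ i → i < k → AdmissibleAt f (j + i)) → T (accepts (history f j) v)
accepts-history f j [] _ _ = _
accepts-history f j (e ∷ v) v≡f admissible with trans (v≡f 0) (cong f (+-identityʳ j))
... | refl = Equivalence.from T-∧
  ( subst (AdmissibleAt f) (+-identityʳ j) (admissible 0 (s≤s z≤n))
  , accepts-history f (suc j) v (λ i → trans (v≡f (suc i)) (cong f (+-suc j i)))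
      (λ i i<k → subst (AdmissibleAt f) (+-suc j i) (admissible (suc i) (s≤s i<k))) )

maximal⇒admissible : ∀ {n} {F : Subset n} → IsMaximalDissociation n F → ∀ j → j < n → AdmissibleAt (χ F) j
maximal⇒admissible _ 0 _ = _
maximal⇒admissible _ 1 _ = _
maximal⇒admissible (dis , _) 2 2<n = dissociation⇒noTriple dis 2<n
maximal⇒admissible (dis , _) 3 3<n = dissociation⇒noTriple dis 3<n
maximal⇒admissible F-max@(dis , _) (suc (suc (suc (suc i)))) i+4<n =
  Equivalence.from T-∧ (dissociation⇒noTriple dis i+4<n , maximal⇒saturated F-max i+4<n)

φC≤count : ∀ n → φC n ≤ count [] n
φC≤count n = begin
  φC n                                 ≤⟨ length-filter≤countᵇ (isMaximalDissociation? n) _ accepted (allSubsets n) ⟩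
  countᵇ (accepts []) (allSubsets n)   ≡⟨ countᵇ-accepts n [] ⟩
  count [] n                           ∎
  where
    open ≤-Reasoning
    accepted : ∀ F → IsMaximalDissociation n F → T (accepts [] F)
    accepted F F-max = accepts-history (χ F) 0 F (λ _ → refl) (λ i → maximal⇒admissible F-max i)

-- An approximate Perron eigenvector of the automaton's transfer matrix on windows of the
-- last four letters, scaled to integers.
weightTable : List Bool → ℕ
weightTable [] = 11944
weightTable (false ∷ []) = 9482
weightTable (true ∷ []) = 7890
weightTable (true ∷ true ∷ _) = 4675
weightTable (false ∷ false ∷ []) = 6800
weightTable (true ∷ false ∷ []) = 6992
weightTable (false ∷ true ∷ []) = 6800
weightTable (false ∷ true ∷ false ∷ _) = 5495
weightTable (false ∷ true ∷ true ∷ _) = 6800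
weightTable (true ∷ false ∷ true ∷ _) = 6992
weightTable (true ∷ false ∷ false ∷ []) = 6992
weightTable (true ∷ false ∷ false ∷ _ ∷ _) = 3215
weightTable (false ∷ false ∷ _ ∷ []) = 2898
weightTable (false ∷ false ∷ true ∷ true ∷ _) = 2898
weightTable (false ∷ false ∷ _ ∷ _ ∷ _) = 1000

weight : List Bool → ℕ
weight h = weightTable (take 4 h)

allUpTo : ℕ → (List Bool → Bool) → Bool
allUpTo zero p = p []
allUpTo (suc k) p = p [] ∧ allUpTo k (p ∘ (true ∷_)) ∧ allUpTo k (p ∘ (false ∷_))

allUpTo-sound : ∀ k p → allUpTo k p ≡ true → ∀ h → length h ≤ k → p h ≡ true
allUpTo-sound zero p all [] _ = all
allUpTo-sound (suc k) p all [] _ = ∧-conicalˡ (p []) _ all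
allUpTo-sound (suc k) p all (true ∷ h) (s≤s h≤k) =
  allUpTo-sound k (p ∘ (true ∷_)) (∧-conicalˡ _ _ (∧-conicalʳ (p []) _ all)) h h≤k
allUpTo-sound (suc k) p all (false ∷ h) (s≤s h≤k) =
  allUpTo-sound k (p ∘ (false ∷_))
    (∧-conicalʳ (allUpTo k (p ∘ (true ∷_))) _ (∧-conicalʳ (p []) _ all)) h h≤k

weightCheck : List Bool → Bool
weightCheck h = (1000 ≤ᵇ weight h) ∧ (11 * next weight h ≤ᵇ 16 * weight h)

weightCheck-window : ∀ h → length h ≤ 4 → weightCheck h ≡ true
weightCheck-window = allUpTo-sound 4 weightCheck refl

-- Only the four most recent letters are inspected, so each history reduces to its window.
weightCheck-all : ∀ h → weightCheck h ≡ true
weightCheck-all [] = weightCheck-window [] z≤n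
weightCheck-all (d ∷ []) = weightCheck-window (d ∷ []) (s≤s z≤n)
weightCheck-all (d ∷ c ∷ []) = weightCheck-window (d ∷ c ∷ []) (s≤s (s≤s z≤n))
weightCheck-all (d ∷ c ∷ b ∷ []) = weightCheck-window (d ∷ c ∷ b ∷ []) (s≤s (s≤s (s≤s z≤n)))
weightCheck-all (d ∷ c ∷ b ∷ a ∷ _) = weightCheck-window (d ∷ c ∷ b ∷ a ∷ []) ≤-refl

weight≥1000 : ∀ h → 1000 ≤ weight h
weight≥1000 h = ≤ᵇ⇒≤ 1000 (weight h) (Equivalence.from T-≡ (∧-conicalˡ _ _ (weightCheck-all h)))

weight-contracts : ∀ h → 11 * next weight h ≤ 16 * weight h
weight-contracts h =
  ≤ᵇ⇒≤ _ (16 * weight h) (Equivalence.from T-≡ (∧-conicalʳ (1000 ≤ᵇ weight h) _ (weightCheck-all h)))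

count≤ : ∀ n → 11 ^ n * (1000 * count [] n) ≤ 16 ^ n * 11944
count≤ n = count-bound weight weight≥1000 weight-contracts n []

^-distribʳ-* : ∀ x y n → (x * y) ^ n ≡ x ^ n * y ^ n
^-distribʳ-* x y zero = refl
^-distribʳ-* x y (suc n) = trans (cong (x * y *_) (^-distribʳ-* x y n)) (interchange x y (x ^ n) (y ^ n))

^-swap : ∀ x m n → (x ^ m) ^ n ≡ (x ^ n) ^ m
^-swap x m n = trans (^-*-assoc x m n) (trans (cong (x ^_) (*-comm m n)) (sym (^-*-assoc x n m)))

geometric-gap : ∀ {a b} K L .{{_ : NonZero b}} {n₀} → a ≤ b → a ^ n₀ * K < b ^ n₀ * L →
                ∀ {n} → n₀ ≤ n → a ^ n * K < b ^ n * L
geometric-gap {a} {b} K L a≤b base n₀≤n with m≤n⇒m<n∨m≡n n₀≤n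
... | inj₂ refl = base
... | inj₁ (s≤s {n = n} n₀≤n′) = begin-strict
  a * a ^ n * K     ≡⟨ *-assoc a (a ^ n) K ⟩
  a * (a ^ n * K)   ≤⟨ *-monoˡ-≤ _ a≤b ⟩
  b * (a ^ n * K)   <⟨ *-monoʳ-< b (geometric-gap K L a≤b base n₀≤n′) ⟩
  b * (b ^ n * L)   ≡⟨ *-assoc b (b ^ n) L ⟨
  b * b ^ n * L     ∎
  where open ≤-Reasoning

-- 65536 = 16^4 and 87846 = 6 · 11^4. Big literals stay right factors: _*_ recurses on
-- its left argument, so a literal on the left unfolds into that many additions.
gap-from-34 : ∀ {n} → 34 ≤ n → 65536 ^ n * 11944 ^ 4 < 87846 ^ n * 1000 ^ 4
gap-from-34 = geometric-gap (11944 ^ 4) (1000 ^ 4) (≤ᵇ⇒≤ 65536 87846 _) (<ᵇ⇒< _ _ _)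

φC-scaled : ∀ n → φC n ^ 4 * (14641 ^ n * 1000 ^ 4) ≤ (16 ^ n * 11944) ^ 4
φC-scaled n = begin
  φC n ^ 4 * (14641 ^ n * 1000 ^ 4)         ≤⟨ *-monoˡ-≤ (14641 ^ n * 1000 ^ 4) (^-monoˡ-≤ 4 (φC≤count n)) ⟩
  count [] n ^ 4 * (14641 ^ n * 1000 ^ 4)   ≡⟨ x∙yz≈z∙xy (14641 ^ n) (1000 ^ 4) (count [] n ^ 4) ⟨
  14641 ^ n * (1000 ^ 4 * count [] n ^ 4)   ≡⟨ cong₂ _*_ (^-swap 11 n 4) (^-distribʳ-* 1000 (count [] n) 4) ⟨
  (11 ^ n) ^ 4 * (1000 * count [] n) ^ 4    ≡⟨ ^-distribʳ-* (11 ^ n) _ 4 ⟨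
  (11 ^ n * (1000 * count [] n)) ^ 4        ≤⟨ ^-monoˡ-≤ 4 (count≤ n) ⟩
  (16 ^ n * 11944) ^ 4                      ∎
  where open ≤-Reasoning

scaled-gap : ∀ {n} → 34 ≤ n → (16 ^ n * 11944) ^ 4 < 6 ^ n * (14641 ^ n * 1000 ^ 4)
scaled-gap {n} 34≤n = subst₂ _<_ (sym left) right (gap-from-34 34≤n)
  where
    left : (16 ^ n * 11944) ^ 4 ≡ 65536 ^ n * 11944 ^ 4
    left = trans (^-distribʳ-* (16 ^ n) 11944 4) (cong (_* 11944 ^ 4) (^-swap 16 n 4))
    right : 87846 ^ n * 1000 ^ 4 ≡ 6 ^ n * (14641 ^ n * 1000 ^ 4)
    right = trans (cong (_* 1000 ^ 4) (^-distribʳ-* 6 14641 n)) (*-assoc (6 ^ n) _ _)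

φC⁴<6ⁿ-large : ∀ {n} → 34 ≤ n → φC n ^ 4 < 6 ^ n
φC⁴<6ⁿ-large {n} 34≤n =
  *-cancelʳ-< (14641 ^ n * 1000 ^ 4) (φC n ^ 4) (6 ^ n) (≤-<-trans (φC-scaled n) (scaled-gap 34≤n))

all-in : (ℕ → Bool) → ℕ → ℕ → Bool
all-in p lo zero = true
all-in p lo (suc k) = p lo ∧ all-in p (suc lo) k

all-in-sound : ∀ p lo k → all-in p lo k ≡ true → ∀ {n} → lo ≤ n → n < lo + k → p n ≡ true
all-in-sound p lo zero _ {n} lo≤n n<lo+0 =
  contradiction (subst (n <_) (+-identityʳ lo) n<lo+0) (≤⇒≯ lo≤n)
all-in-sound p lo (suc k) all {n} lo≤n n<lo+1+k with m≤n⇒m<n∨m≡n lo≤n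
... | inj₂ refl = ∧-conicalˡ (p lo) _ all
... | inj₁ lo<n =
  all-in-sound p (suc lo) k (∧-conicalʳ (p lo) _ all) lo<n (subst (n <_) (+-suc lo k) n<lo+1+k)

φC⁴<6ⁿ-small : ∀ {n} → 3 ≤ n → n ≢ 4 → n < 10 → φC n ^ 4 < 6 ^ n
φC⁴<6ⁿ-small {n} 3≤n n≢4 n<10 =
  <ᵇ⇒< _ _ (Equivalence.from T-≡ (skip-4 (all-in-sound small 3 7 refl 3≤n n<10)))
  where
    small : ℕ → Bool
    small k = (k ≡ᵇ 4) ∨ (φC k ^ 4 <ᵇ 6 ^ k)
    skip-4 : small n ≡ true → (φC n ^ 4 <ᵇ 6 ^ n) ≡ true
    skip-4 with n ≡ᵇ 4 in n≡4
    ... | true = contradiction (≡ᵇ⇒≡ n 4 (Equivalence.from T-≡ n≡4)) n≢4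
    ... | false = λ sat → sat

count⁴<6ⁿ-middle : ∀ {n} → 10 ≤ n → n < 34 → count [] n ^ 4 < 6 ^ n
count⁴<6ⁿ-middle 10≤n n<34 =
  <ᵇ⇒< _ _ (Equivalence.from T-≡ (all-in-sound (λ k → count [] k ^ 4 <ᵇ 6 ^ k) 10 24 refl 10≤n n<34))

φC⁴<6ⁿ : ∀ n → 3 ≤ n → n ≢ 4 → φC n ^ 4 < 6 ^ n
φC⁴<6ⁿ n 3≤n n≢4 with n <? 10 | n <? 34
... | yes n<10 | _ = φC⁴<6ⁿ-small 3≤n n≢4 n<10
... | no n≮10 | yes n<34 = ≤-<-trans (^-monoˡ-≤ 4 (φC≤count n)) (count⁴<6ⁿ-middle (≮⇒≥ n≮10) n<34)
... | _ | no n≮34 = φC⁴<6ⁿ-large (≮⇒≥ n≮34)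

lemma2p6 : (n : ℕ) → 3 ≤ n →
    ((φC n) ^ 4 ≤ 6 ^ n) × (((φC n) ^ 4 ≡ 6 ^ n) ⇔ (n ≡ 4))
lemma2p6 n 3≤n with n ≟ 4
... | yes refl = ≤-refl , mk⇔ (λ _ → refl) (λ _ → refl)
... | no n≢4 = <⇒≤ φ⁴<6ⁿ , mk⇔ (⊥-elim ∘ <⇒≢ φ⁴<6ⁿ) (⊥-elim ∘ n≢4)
  where φ⁴<6ⁿ = φC⁴<6ⁿ n 3≤n n≢4
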